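{- Let $G$ be a graph with $n$ vertices and $m$ edges. Then $\psi_3(G)\le \frac{2n+m}{6}$.
   Context: Graphs are finite and simple. A subset $S\subseteq V(G)$ is a $3$-path vertex cover of $G$ if every path on $3$ vertices in $G$ contains at least one vertex of $S$; $\psi_3(G)$ denotes the minimum cardinality of a $3$-path vertex cover of $G$. -}

module Defs where

open import Data.Nat using (ℕ; zero; suc; _+_; _*_; _≤_)
open import Data.Bool using (Bool; true; false; T; _∧_)
open import Data.Bool.Properties using (T?)
open import Data.Fin using (Fin; _<_; _<?_)
open import Data.Fin.Subset using (Subset; _∈_; ∣_∣)
open import Data.List using (List; allFin; filter; length; map)
open import Data.Nat.ListAction using (sum)
open import Data.Product using (Σ; _×_)
open import Data.Sum using (_⊎_)
open import Relation.Nullary using (¬_)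
open import Relation.Nullary.Decidable using (⌊_⌋)
open import Relation.Binary.PropositionalEquality using (_≡_)

record Graph (n : ℕ) : Set where
  field
    adj   : Fin n → Fin n → Bool
    adj-sym   : ∀ u v → adj u v ≡ adj v u
    adj-irref : ∀ v → adj v v ≡ false
open Graph public

_~[_]_ : ∀ {n} → Fin n → Graph n → Fin n → Set
u ~[ G ] v = T (adj G u v)

numEdges : ∀ {n} → Graph n → ℕ
numEdges {n} G =
  sum (map (λ u → length (filter (λ v → T? (⌊ u <? v ⌋ ∧ adj G u v)) (allFin n)))
           (allFin n))

IsP3 : ∀ {n} → Graph n → Fin n → Fin n → Fin n → Set
IsP3 G u v w = (u ~[ G ] v) × (v ~[ G ] w) × ¬ (u ≡ w)

Is3PathVertexCover : ∀ {n} → Graph n → Subset n → Set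
Is3PathVertexCover G S =
  ∀ u v w → IsP3 G u v w → (u ∈ S) ⊎ (v ∈ S) ⊎ (w ∈ S)

-- Induct on the vertex set U of an induced subgraph G[U], keeping a 3-path cover S of G[U]
-- with 12 |S| ≤ 4 |U| + Σ_{v ∈ U} deg_U v  (the right-hand side is 4 |U| + 2 e(G[U])).
-- A vertex of degree ≥ 4, or a neighbour of degree ≥ 2 of a vertex of degree ≤ 1, is put into
-- S and deleted (in the second case together with the low-degree vertex); either move lowers
-- the right-hand side by at least 12.  When neither applies, G[U] has maximum degree ≤ 3 and
-- the vertices of degree ≥ 2 form a union of components.  By Lovász's switching argument U has
-- a 2-colouring in which every vertex has at most one neighbour of its own colour, so no P3
-- of G[U] is monochromatic; hence either colour class, restricted to the vertices of degree
-- ≥ 2, is a cover, and the smaller one has at most (1/2) #{v : deg v ≥ 2} ≤ (4 |U| + 2 e) / 12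
-- vertices.
module Submission where

open import Defs
open import Data.Nat using (ℕ; zero; suc; _+_; _*_; _≤_; _<_; _≤?_; _≤ᵇ_; z≤n; s≤s)
open import Data.Nat.Properties hiding (suc-injective; _≟_; _<?_; <-cmp; <-asym)
open import Data.Nat.Induction using (<-wellFounded)
open import Data.Nat.Tactic.RingSolver using (solve-∀)
import Data.Nat.ListAction as ListAction
open import Algebra.Properties.CommutativeMonoid.Sum +-0-commutativeMonoid
  using (sum; sum-cong-≗; sum-replicate-zero; ∑-distrib-+; ∑-comm)
open import Algebra.Properties.Semiring.Sum +-*-semiring using (*-distribˡ-sum)
open import Data.Bool using (Bool; true; false; T; _∧_; not)
open import Data.Bool.Properties
  using (T-≡; ∧-zeroʳ; ∧-identityʳ; ¬-not) renaming (_≟_ to _≟ᵇ_)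
open import Data.Empty using (⊥-elim)
open import Data.Fin using (Fin; zero; suc; _<?_)
open import Data.Fin.Properties using (_≟_; any?; suc-injective; <-cmp; <-asym)
open import Data.Fin.Subset using (Subset; ∣_∣; _∈_)
open import Data.List using ([]; _∷_; allFin; filter; length; map)
open import Data.List.Properties using (map-tabulate)
import Data.List as List
open import Data.Product using (Σ; _×_; _,_; proj₁; proj₂)
open import Data.Sum as Sum using (_⊎_; inj₁; inj₂)
open import Data.Vec using (tabulate)
open import Data.Vec.Properties using (lookup⇒[]=; lookup∘tabulate)
open import Data.Vec.Functional using (updateAt)
open import Data.Vec.Functional.Properties using (updateAt-updates; updateAt-minimal)
open import Function using (_∘_; _on_; id)
open import Function.Bundles using (Equivalence)
open import Induction.WellFounded using (Acc; acc)
import Relation.Binary.Construct.On as On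
open import Relation.Binary.Definitions using (tri<; tri≈; tri>)
open import Relation.Binary.PropositionalEquality
open import Relation.Nullary using (¬_; yes; no)
open import Relation.Nullary.Decidable using (⌊_⌋; _×-dec_)
open import Relation.Nullary.Decidable.Core using (T?)

𝟙 : Bool → ℕ
𝟙 true  = 1
𝟙 false = 0

T⇒≡true : ∀ {b} → T b → b ≡ true
T⇒≡true = Equivalence.to T-≡

updateAt-minimal-true : ∀ {n} {X : Fin n → Bool} {f : Bool → Bool} {v w : Fin n} →
                        w ≢ v → X w ≡ true → updateAt X v f w ≡ true
updateAt-minimal-true {X = X} {v = v} {w} w≢v Xw = trans (updateAt-minimal w v X w≢v) Xw

sum-mono-≤ : ∀ {n} {f g : Fin n → ℕ} → (∀ i → f i ≤ g i) → sum f ≤ sum g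
sum-mono-≤ {zero}  f≤g = z≤n
sum-mono-≤ {suc n} f≤g = +-mono-≤ (f≤g zero) (sum-mono-≤ (f≤g ∘ suc))

term≤sum : ∀ {n} (f : Fin n → ℕ) i → f i ≤ sum f
term≤sum f zero    = m≤m+n (f zero) _
term≤sum f (suc i) = ≤-trans (term≤sum (f ∘ suc) i) (m≤n+m _ (f zero))

sum-exchange : ∀ {n} {f g : Fin n → ℕ} v → (∀ w → w ≢ v → f w ≡ g w) →
               sum f + g v ≡ sum g + f v
sum-exchange {suc n} {f} {g} zero agree = begin
    f zero + sum (f ∘ suc) + g zero  ≡⟨ cong (λ t → f zero + t + g zero) tails ⟩
    f zero + sum (g ∘ suc) + g zero  ≡⟨ swap-outer (f zero) _ (g zero) ⟩
    g zero + sum (g ∘ suc) + f zero  ∎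
  where
  open ≡-Reasoning
  tails : sum (f ∘ suc) ≡ sum (g ∘ suc)
  tails = sum-cong-≗ (λ i → agree (suc i) λ ())
  swap-outer : ∀ a b c → a + b + c ≡ c + b + a
  swap-outer = solve-∀
sum-exchange {suc n} {f} {g} (suc v) agree = begin
    f zero + sum (f ∘ suc) + g (suc v)    ≡⟨ +-assoc (f zero) _ _ ⟩
    f zero + (sum (f ∘ suc) + g (suc v))  ≡⟨ cong₂ _+_ (agree zero λ ()) tails ⟩
    g zero + (sum (g ∘ suc) + f (suc v))  ≡⟨ +-assoc (g zero) _ _ ⟨
    g zero + sum (g ∘ suc) + f (suc v)    ∎
  where
  open ≡-Reasoning
  tails : sum (f ∘ suc) + g (suc v) ≡ sum (g ∘ suc) + f (suc v)
  tails = sum-exchange v (λ w w≢v → agree (suc w) (w≢v ∘ suc-injective))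

two-terms≤sum : ∀ {n} (f : Fin n → ℕ) {i j} → i ≢ j → f i + f j ≤ sum f
two-terms≤sum f {i} {j} i≢j = begin
    f i + f j    ≡⟨ cong (f i +_) (updateAt-minimal j i f (i≢j ∘ sym)) ⟨
    f i + g j    ≤⟨ +-monoʳ-≤ (f i) (term≤sum g j) ⟩
    f i + sum g  ≡⟨ +-comm (f i) (sum g) ⟩
    sum g + f i  ≡⟨ sum-exchange i (λ w w≢i → updateAt-minimal w i f w≢i) ⟩
    sum f + g i  ≡⟨ cong (sum f +_) (updateAt-updates i f) ⟩
    sum f + 0    ≡⟨ +-identityʳ (sum f) ⟩
    sum f        ∎
  where
  open ≤-Reasoning
  g : Fin _ → ℕ
  g = updateAt f i (λ _ → 0)

∑∑ : ∀ {n} → (Fin n → Fin n → ℕ) → ℕ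
∑∑ h = sum λ u → sum (h u)

-- Row v enters the double sum once as a row and once as a column, hence the factor 2.
∑∑-exchange : ∀ {n} {h h′ : Fin n → Fin n → ℕ} v →
              (∀ u w → h u w ≡ h w u) → (∀ u w → h′ u w ≡ h′ w u) →
              h v v ≡ 0 → h′ v v ≡ 0 →
              (∀ u w → u ≢ v → w ≢ v → h u w ≡ h′ u w) →
              ∑∑ h + 2 * sum (h′ v) ≡ ∑∑ h′ + 2 * sum (h v)
∑∑-exchange {h = h} {h′} v h-sym h′-sym hvv h′vv agree = begin
    ∑∑ h + 2 * sum (h′ v)                  ≡⟨ double (∑∑ h) (sum (h′ v)) hvv ⟩
    ∑∑ h + sum (h′ v) + (sum (h′ v) + h v v)  ≡⟨ cong (_+ r′ v) (columns h h′ h′-sym) ⟨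
    sum r + r′ v                           ≡⟨ sum-exchange v rows-agree ⟩
    sum r′ + r v                           ≡⟨ cong (_+ r v) (columns h′ h h-sym) ⟩
    ∑∑ h′ + sum (h v) + (sum (h v) + h′ v v)  ≡⟨ double (∑∑ h′) (sum (h v)) h′vv ⟨
    ∑∑ h′ + 2 * sum (h v)                  ∎
  where
  open ≡-Reasoning
  r r′ : _ → ℕ
  r u = sum (h u) + h′ u v
  r′ u = sum (h′ u) + h u v
  rows-agree : ∀ u → u ≢ v → r u ≡ r′ u
  rows-agree u u≢v = sum-exchange v (λ w w≢v → agree u w u≢v w≢v)
  columns : ∀ k k′ → (∀ u w → k′ u w ≡ k′ w u) →
            sum (λ u → sum (k u) + k′ u v) ≡ ∑∑ k + sum (k′ v)
  columns k k′ k′-sym =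
    trans (∑-distrib-+ (λ u → sum (k u)) (λ u → k′ u v))
          (cong (∑∑ k +_) (sum-cong-≗ λ u → k′-sym u v))
  double : ∀ a s {d} → d ≡ 0 → a + 2 * s ≡ a + s + (s + d)
  double a s refl = arith a s
    where
    arith : ∀ a s → a + 2 * s ≡ a + s + (s + 0)
    arith = solve-∀

sumList-tabulate : ∀ {n} (f : Fin n → ℕ) → ListAction.sum (List.tabulate f) ≡ sum f
sumList-tabulate {zero}  f = refl
sumList-tabulate {suc n} f = cong (f zero +_) (sumList-tabulate (f ∘ suc))

sumList-allFin : ∀ {n} (f : Fin n → ℕ) → ListAction.sum (map f (allFin n)) ≡ sum f
sumList-allFin f = trans (cong ListAction.sum (map-tabulate id f)) (sumList-tabulate f)

length-filter-T? : ∀ {A : Set} (p : A → Bool) xs →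
                   length (filter (T? ∘ p) xs) ≡ ListAction.sum (map (𝟙 ∘ p) xs)
length-filter-T? p []       = refl
length-filter-T? p (y ∷ ys) with p y
... | true  = cong suc (length-filter-T? p ys)
... | false = length-filter-T? p ys

module _ {n : ℕ} where

  _─_ : (Fin n → Bool) → Fin n → Fin n → Bool
  U ─ v = updateAt U v (λ _ → false)

  insert : Fin n → (Fin n → Bool) → Fin n → Bool
  insert v S = updateAt S v (λ _ → true)

  size : (Fin n → Bool) → ℕ
  size U = sum (𝟙 ∘ U)

  size-─ : ∀ {U} v → U v ≡ true → size U ≡ suc (size (U ─ v))
  size-─ {U} v Uv = begin
      size U                  ≡⟨ +-identityʳ (size U) ⟨
      size U + 0              ≡⟨ cong (λ b → size U + 𝟙 b) (updateAt-updates v U) ⟨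
      size U + 𝟙 ((U ─ v) v)  ≡⟨ sum-exchange v agree ⟩
      size (U ─ v) + 𝟙 (U v)  ≡⟨ cong (λ b → size (U ─ v) + 𝟙 b) Uv ⟩
      size (U ─ v) + 1        ≡⟨ +-comm (size (U ─ v)) 1 ⟩
      suc (size (U ─ v))      ∎
    where
    open ≡-Reasoning
    agree : ∀ w → w ≢ v → 𝟙 (U w) ≡ 𝟙 ((U ─ v) w)
    agree w w≢v = cong 𝟙 (sym (updateAt-minimal w v U w≢v))

  size-insert : ∀ v S → size (insert v S) ≤ suc (size S)
  size-insert v S = begin
      size (insert v S)            ≤⟨ m≤m+n _ (𝟙 (S v)) ⟩
      size (insert v S) + 𝟙 (S v)  ≡⟨ sum-exchange v agree ⟩
      size S + 𝟙 (insert v S v)    ≡⟨ cong (λ b → size S + 𝟙 b) (updateAt-updates v S) ⟩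
      size S + 1                   ≡⟨ +-comm (size S) 1 ⟩
      suc (size S)                 ∎
    where
    open ≤-Reasoning
    agree : ∀ w → w ≢ v → 𝟙 (insert v S w) ≡ 𝟙 (S w)
    agree w w≢v = cong 𝟙 (updateAt-minimal w v S w≢v)

module _ {n : ℕ} (G : Graph n) where

  ~-sym : ∀ {u v} → u ~[ G ] v → v ~[ G ] u
  ~-sym {u} {v} = subst T (adj-sym G u v)

  ~-irrefl : ∀ {u v} → u ~[ G ] v → u ≢ v
  ~-irrefl {u} u~u refl = subst T (adj-irref G u) u~u

  -- deg U v is the degree of v in G[U] (0 for v ∉ U), and degSum U = 2 e(G[U]).
  edgeIn : (Fin n → Bool) → Fin n → Fin n → ℕ
  edgeIn U u w = 𝟙 (U u ∧ adj G u w ∧ U w)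

  deg : (Fin n → Bool) → Fin n → ℕ
  deg U v = sum (edgeIn U v)

  degSum : (Fin n → Bool) → ℕ
  degSum U = ∑∑ (edgeIn U)

  edgeIn-sym : ∀ U u w → edgeIn U u w ≡ edgeIn U w u
  edgeIn-sym U u w rewrite adj-sym G u w with U u | U w
  ... | true  | true  = refl
  ... | true  | false = cong 𝟙 (∧-zeroʳ (adj G w u))
  ... | false | true  = sym (cong 𝟙 (∧-zeroʳ (adj G w u)))
  ... | false | false = refl

  edgeIn-irrefl : ∀ U v → edgeIn U v v ≡ 0
  edgeIn-irrefl U v rewrite adj-irref G v = cong 𝟙 (∧-zeroʳ (U v))

  edgeIn-≡1 : ∀ {U u w} → U u ≡ true → u ~[ G ] w → U w ≡ true → edgeIn U u w ≡ 1
  edgeIn-≡1 {U} {u} {w} Uu u~w Uw rewrite Uu | T⇒≡true u~w | Uw = refl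

  deg-∉ : ∀ U {v} → U v ≡ false → deg U v ≡ 0
  deg-∉ U {v} Uv = trans (sum-cong-≗ λ w → cong (λ b → 𝟙 (b ∧ adj G v w ∧ U w)) Uv)
                           (sum-replicate-zero n)

  deg>⇒∈ : ∀ U {v k} → k < deg U v → U v ≡ true
  deg>⇒∈ U {v} {k} k<deg with U v ≟ᵇ true
  ... | yes Uv = Uv
  ... | no ¬Uv = ⊥-elim (n≮0 (subst (k <_) (deg-∉ U (¬-not ¬Uv)) k<deg))

  neighbours⇒2≤deg : ∀ {U a b c} → a ≢ c → U b ≡ true → U a ≡ true → U c ≡ true →
                     b ~[ G ] a → b ~[ G ] c → 2 ≤ deg U b
  neighbours⇒2≤deg {U} {a} {b} {c} a≢c Ub Ua Uc b~a b~c =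
    subst₂ (λ p q → p + q ≤ deg U b) (edgeIn-≡1 Ub b~a Ua) (edgeIn-≡1 Ub b~c Uc)
           (two-terms≤sum (edgeIn U b) a≢c)

  degSum-─ : ∀ {U} v → U v ≡ true → degSum U ≡ degSum (U ─ v) + 2 * deg U v
  degSum-─ {U} v Uv = begin
      degSum U
        ≡⟨ +-identityʳ (degSum U) ⟨
      degSum U + 2 * 0
        ≡⟨ cong (λ d → degSum U + 2 * d) (deg-∉ (U ─ v) (updateAt-updates v U)) ⟨
      degSum U + 2 * deg (U ─ v) v
        ≡⟨ ∑∑-exchange v (edgeIn-sym U) (edgeIn-sym (U ─ v))
                         (edgeIn-irrefl U v) (edgeIn-irrefl (U ─ v) v) agree ⟩
      degSum (U ─ v) + 2 * deg U v
        ∎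
    where
    open ≡-Reasoning
    agree : ∀ u w → u ≢ v → w ≢ v → edgeIn U u w ≡ edgeIn (U ─ v) u w
    agree u w u≢v w≢v = cong₂ (λ p q → 𝟙 (p ∧ adj G u w ∧ q))
      (sym (updateAt-minimal u v U u≢v)) (sym (updateAt-minimal w v U w≢v))

  CoversIn : (Fin n → Bool) → (Fin n → Bool) → Set
  CoversIn U S = ∀ a b c → U a ≡ true → U b ≡ true → U c ≡ true → IsP3 G a b c →
                 S a ≡ true ⊎ S b ≡ true ⊎ S c ≡ true

  covers-insert : ∀ {U S} v → CoversIn (U ─ v) S → CoversIn U (insert v S)
  covers-insert {U} {S} v cover a b c Ua Ub Uc abc with a ≟ v | b ≟ v | c ≟ v
  ... | yes refl | _        | _        = inj₁ (updateAt-updates v S)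
  ... | no _     | yes refl | _        = inj₂ (inj₁ (updateAt-updates v S))
  ... | no _     | no _     | yes refl = inj₂ (inj₂ (updateAt-updates v S))
  ... | no a≢v   | no b≢v   | no c≢v   =
    Sum.map (updateAt-minimal-true a≢v)
            (Sum.map (updateAt-minimal-true b≢v) (updateAt-minimal-true c≢v))
      (cover a b c (updateAt-minimal-true a≢v Ua) (updateAt-minimal-true b≢v Ub)
                   (updateAt-minimal-true c≢v Uc) abc)

  covers-isolated : ∀ {U S} u → (∀ w → U w ≡ true → ¬ u ~[ G ] w) →
                    CoversIn (U ─ u) S → CoversIn U S
  covers-isolated {U} u isolated cover a b c Ua Ub Uc abc@(a~b , b~c , _) with a ≟ u | b ≟ u | c ≟ u
  ... | yes refl | _        | _        = ⊥-elim (isolated b Ub a~b)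
  ... | no _     | yes refl | _        = ⊥-elim (isolated c Uc b~c)
  ... | no _     | no _     | yes refl = ⊥-elim (isolated b Ub (~-sym b~c))
  ... | no a≢u   | no b≢u   | no c≢u   =
    cover a b c (updateAt-minimal-true a≢u Ua) (updateAt-minimal-true b≢u Ub)
                (updateAt-minimal-true c≢u Uc) abc

  potential : (Fin n → Bool) → ℕ
  potential U = 4 * size U + degSum U

  potential-─ : ∀ {U} v → U v ≡ true → potential U ≡ 4 + 2 * deg U v + potential (U ─ v)
  potential-─ {U} v Uv = begin
      4 * size U + degSum U
        ≡⟨ cong₂ (λ s d → 4 * s + d) (size-─ v Uv) (degSum-─ v Uv) ⟩
      4 * suc (size (U ─ v)) + (degSum (U ─ v) + 2 * deg U v)
        ≡⟨ arith (size (U ─ v)) (degSum (U ─ v)) (deg U v) ⟩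
      4 + 2 * deg U v + potential (U ─ v)
        ∎
    where
    open ≡-Reasoning
    arith : ∀ s e d → 4 * suc s + (e + 2 * d) ≡ 4 + 2 * d + (4 * s + e)
    arith = solve-∀

  SmallCover : (Fin n → Bool) → Set
  SmallCover U = Σ (Fin n → Bool) λ S → CoversIn U S × 12 * size S ≤ potential U

  insert-preserves-bound : ∀ {p p′} (S : Fin n → Bool) v → 12 + p′ ≤ p → 12 * size S ≤ p′ →
                           12 * size (insert v S) ≤ p
  insert-preserves-bound {p} {p′} S v gain bound = begin
      12 * size (insert v S)  ≤⟨ *-monoʳ-≤ 12 (size-insert v S) ⟩
      12 * suc (size S)       ≡⟨ *-suc 12 (size S) ⟩
      12 + 12 * size S        ≤⟨ +-monoʳ-≤ 12 bound ⟩
      12 + p′                 ≤⟨ gain ⟩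
      p                       ∎
    where open ≤-Reasoning

  smallCover-high-degree : ∀ {U} v → 4 ≤ deg U v → SmallCover (U ─ v) → SmallCover U
  smallCover-high-degree {U} v 4≤deg (S , cover , bound) =
    insert v S , covers-insert v cover , insert-preserves-bound S v gain bound
    where
    open ≤-Reasoning
    gain : 12 + potential (U ─ v) ≤ potential U
    gain = begin
      12 + potential (U ─ v)               ≤⟨ +-monoˡ-≤ _ (+-monoʳ-≤ 4 (*-monoʳ-≤ 2 4≤deg)) ⟩
      4 + 2 * deg U v + potential (U ─ v)  ≡⟨ potential-─ v (deg>⇒∈ U 4≤deg) ⟨
      potential U                          ∎

  smallCover-pendant : ∀ {U u v} → U u ≡ true → u ~[ G ] v → deg U u ≤ 1 → 2 ≤ deg U v →
                       SmallCover ((U ─ v) ─ u) → SmallCover U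
  smallCover-pendant {U} {u} {v} Uu u~v deg-u≤1 2≤deg-v (S , cover , bound) =
    insert v S , covers-insert v (covers-isolated u isolated cover) , insert-preserves-bound S v gain bound
    where
    Uv : U v ≡ true
    Uv = deg>⇒∈ U 2≤deg-v
    U′u : (U ─ v) u ≡ true
    U′u = updateAt-minimal-true (~-irrefl u~v) Uu
    isolated : ∀ w → (U ─ v) w ≡ true → ¬ u ~[ G ] w
    isolated w U′w u~w = <⇒≱ (neighbours⇒2≤deg w≢v Uu Uw Uv u~w u~v) deg-u≤1
      where
      w≢v : w ≢ v
      w≢v refl with () ← trans (sym (updateAt-updates v U)) U′w
      Uw : U w ≡ true
      Uw = trans (sym (updateAt-minimal w v U w≢v)) U′w
    open ≤-Reasoning
    gain : 12 + potential ((U ─ v) ─ u) ≤ potential U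
    gain = begin
      12 + potential ((U ─ v) ─ u)
        ≤⟨ +-monoˡ-≤ _ (+-monoʳ-≤ 4 (*-monoʳ-≤ 2 2≤deg-v)) ⟩
      4 + 2 * deg U v + (4 + potential ((U ─ v) ─ u))
        ≤⟨ +-monoʳ-≤ (4 + 2 * deg U v)
                     (+-monoˡ-≤ (potential ((U ─ v) ─ u)) (m≤m+n 4 (2 * deg (U ─ v) u))) ⟩
      4 + 2 * deg U v + (4 + 2 * deg (U ─ v) u + potential ((U ─ v) ─ u))
        ≡⟨ cong (4 + 2 * deg U v +_) (potential-─ u U′u) ⟨
      4 + 2 * deg U v + potential (U ─ v)
        ≡⟨ potential-─ v Uv ⟨
      potential U
        ∎

  monoEdgeIn : (Fin n → Bool) → (Fin n → Bool) → Fin n → Fin n → ℕ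
  monoEdgeIn U x u w = edgeIn U u w * 𝟙 ⌊ x u ≟ᵇ x w ⌋

  sameDeg : (Fin n → Bool) → (Fin n → Bool) → Fin n → ℕ
  sameDeg U x v = sum (monoEdgeIn U x v)

  monoCount : (Fin n → Bool) → (Fin n → Bool) → ℕ
  monoCount U x = ∑∑ (monoEdgeIn U x)

  recolour : (Fin n → Bool) → Fin n → Fin n → Bool
  recolour x v = updateAt x v not

  sameDeg-recolour : ∀ U x v → sameDeg U (recolour x v) v + sameDeg U x v ≡ deg U v
  sameDeg-recolour U x v =
    trans (sym (∑-distrib-+ (monoEdgeIn U (recolour x v) v) (monoEdgeIn U x v))) (sum-cong-≗ split)
    where
    open ≡-Reasoning
    colours : ∀ a b → 𝟙 ⌊ not a ≟ᵇ b ⌋ + 𝟙 ⌊ a ≟ᵇ b ⌋ ≡ 1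
    colours false false = refl
    colours false true  = refl
    colours true  false = refl
    colours true  true  = refl
    split : ∀ w → monoEdgeIn U (recolour x v) v w + monoEdgeIn U x v w ≡ edgeIn U v w
    split w with w ≟ v
    ... | yes refl rewrite edgeIn-irrefl U v = refl
    ... | no w≢v = begin
      e * 𝟙 ⌊ recolour x v v ≟ᵇ recolour x v w ⌋ + e * 𝟙 ⌊ x v ≟ᵇ x w ⌋
        ≡⟨ *-distribˡ-+ e _ _ ⟨
      e * (𝟙 ⌊ recolour x v v ≟ᵇ recolour x v w ⌋ + 𝟙 ⌊ x v ≟ᵇ x w ⌋)
        ≡⟨ cong (e *_) (trans (cong₂ (λ p q → 𝟙 ⌊ p ≟ᵇ q ⌋ + 𝟙 ⌊ x v ≟ᵇ x w ⌋)
                                     (updateAt-updates v x) (updateAt-minimal w v x w≢v))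
                              (colours (x v) (x w))) ⟩
      e * 1
        ≡⟨ *-identityʳ e ⟩
      e ∎
      where
      e = edgeIn U v w

  -- Only edges at v change status, and afterwards v has at most 3 − 2 = 1 neighbour of its colour.
  monoCount-recolour< : ∀ U x v → deg U v ≤ 3 → 2 ≤ sameDeg U x v →
                        monoCount U (recolour x v) < monoCount U x
  monoCount-recolour< U x v deg≤3 2≤s = +-cancelʳ-< (2 * s) M′ M (begin-strict
      M′ + 2 * s   ≡⟨ exchange ⟨
      M + 2 * s′   <⟨ +-monoʳ-< M (*-monoʳ-< 2 s′<s) ⟩
      M + 2 * s    ∎)
    where
    open ≤-Reasoning
    x′ = recolour x v
    M = monoCount U x
    M′ = monoCount U x′
    s = sameDeg U x v
    s′ = sameDeg U x′ v
    same-colour-sym : ∀ a b → 𝟙 ⌊ a ≟ᵇ b ⌋ ≡ 𝟙 ⌊ b ≟ᵇ a ⌋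
    same-colour-sym false false = refl
    same-colour-sym false true  = refl
    same-colour-sym true  false = refl
    same-colour-sym true  true  = refl
    monoEdgeIn-sym : ∀ y u w → monoEdgeIn U y u w ≡ monoEdgeIn U y w u
    monoEdgeIn-sym y u w = cong₂ _*_ (edgeIn-sym U u w) (same-colour-sym (y u) (y w))
    monoEdgeIn-irrefl : ∀ y → monoEdgeIn U y v v ≡ 0
    monoEdgeIn-irrefl y = cong (_* _) (edgeIn-irrefl U v)
    agree : ∀ u w → u ≢ v → w ≢ v → monoEdgeIn U x u w ≡ monoEdgeIn U x′ u w
    agree u w u≢v w≢v = cong₂ (λ p q → edgeIn U u w * 𝟙 ⌊ p ≟ᵇ q ⌋)
      (sym (updateAt-minimal u v x u≢v)) (sym (updateAt-minimal w v x w≢v))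
    exchange : M + 2 * s′ ≡ M′ + 2 * s
    exchange = ∑∑-exchange v (monoEdgeIn-sym x) (monoEdgeIn-sym x′)
                             (monoEdgeIn-irrefl x) (monoEdgeIn-irrefl x′) agree
    s′<s : s′ < s
    s′<s = ≤-trans (s≤s (+-cancelʳ-≤ 2 s′ 1 (begin
      s′ + 2   ≤⟨ +-monoʳ-≤ s′ 2≤s ⟩
      s′ + s   ≡⟨ sameDeg-recolour U x v ⟩
      deg U v  ≤⟨ deg≤3 ⟩
      3        ∎))) 2≤s

  lovász-colouring : ∀ U → (∀ v → deg U v ≤ 3) →
                     Σ (Fin n → Bool) λ x → ∀ v → sameDeg U x v ≤ 1
  lovász-colouring U subcubic = descend (λ _ → false) (On.wellFounded (monoCount U) <-wellFounded _)
    where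
    descend : ∀ x → Acc (_<_ on monoCount U) x → Σ (Fin n → Bool) λ x → ∀ v → sameDeg U x v ≤ 1
    descend x (acc smaller) with any? (λ v → 2 ≤? sameDeg U x v)
    ... | yes (v , 2≤s) = descend (recolour x v) (smaller (monoCount-recolour< U x v (subcubic v) 2≤s))
    ... | no none       = x , λ v → ≤-pred (≰⇒> λ 2≤s → none (v , 2≤s))

  heavyClass : (Fin n → Bool) → (Fin n → Bool) → Bool → Fin n → Bool
  heavyClass U x s v = (2 ≤ᵇ deg U v) ∧ ⌊ x v ≟ᵇ s ⌋

  heavyClass-covers : ∀ {U x} s → (∀ v → sameDeg U x v ≤ 1) →
                      (∀ u v → U u ≡ true → u ~[ G ] v → 2 ≤ deg U v → 2 ≤ deg U u) →
                      CoversIn U (heavyClass U x s)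
  heavyClass-covers {U} {x} s proper heavy-closed a b c Ua Ub Uc (a~b , b~c , a≢c)
    with heavyClass U x s a in ea | heavyClass U x s b in eb | heavyClass U x s c in ec
  ... | true  | _     | _     = inj₁ refl
  ... | false | true  | _     = inj₂ (inj₁ refl)
  ... | false | false | true  = inj₂ (inj₂ refl)
  ... | false | false | false = ⊥-elim (<⇒≱ 2≤sameDeg (proper b))
    where
    2≤b : 2 ≤ deg U b
    2≤b = neighbours⇒2≤deg a≢c Ub Ua Uc (~-sym a~b) b~c
    other-colour : ∀ {v} → 2 ≤ deg U v → heavyClass U x s v ≡ false → x v ≡ not s
    other-colour {v} 2≤deg eq =
      ≟-false (x v) s (trans (cong (_∧ ⌊ x v ≟ᵇ s ⌋) (sym (T⇒≡true (≤⇒≤ᵇ 2≤deg)))) eq)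
      where
      ≟-false : ∀ p q → ⌊ p ≟ᵇ q ⌋ ≡ false → p ≡ not q
      ≟-false false true  _ = refl
      ≟-false true  false _ = refl
    xa≡xb : x a ≡ x b
    xa≡xb = trans (other-colour (heavy-closed a b Ua a~b 2≤b) ea) (sym (other-colour 2≤b eb))
    xc≡xb : x c ≡ x b
    xc≡xb = trans (other-colour (heavy-closed c b Uc (~-sym b~c) 2≤b) ec) (sym (other-colour 2≤b eb))
    same-neighbour : ∀ {w} → U w ≡ true → b ~[ G ] w → x w ≡ x b → monoEdgeIn U x b w ≡ 1
    same-neighbour {w} Uw b~w xw≡xb rewrite edgeIn-≡1 Ub b~w Uw | xw≡xb with x b
    ... | false = refl
    ... | true  = refl
    2≤sameDeg : 2 ≤ sameDeg U x b
    2≤sameDeg = subst₂ (λ p q → p + q ≤ sameDeg U x b)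
      (same-neighbour Ua (~-sym a~b) xa≡xb) (same-neighbour Uc b~c xc≡xb)
      (two-terms≤sum (monoEdgeIn U x b) a≢c)

  heavy≤potential : ∀ U → 6 * size (λ v → 2 ≤ᵇ deg U v) ≤ potential U
  heavy≤potential U = begin
      6 * size (λ v → 2 ≤ᵇ deg U v)
        ≡⟨ *-distribˡ-sum 6 (λ v → 𝟙 (2 ≤ᵇ deg U v)) ⟩
      sum (λ v → 6 * 𝟙 (2 ≤ᵇ deg U v))
        ≤⟨ sum-mono-≤ pointwise ⟩
      sum (λ v → 4 * 𝟙 (U v) + deg U v)
        ≡⟨ ∑-distrib-+ (λ v → 4 * 𝟙 (U v)) (deg U) ⟩
      sum (λ v → 4 * 𝟙 (U v)) + degSum U
        ≡⟨ cong (_+ degSum U) (*-distribˡ-sum 4 (𝟙 ∘ U)) ⟨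
      potential U
        ∎
    where
    open ≤-Reasoning
    pointwise : ∀ v → 6 * 𝟙 (2 ≤ᵇ deg U v) ≤ 4 * 𝟙 (U v) + deg U v
    pointwise v with 2 ≤ᵇ deg U v in heavy
    ... | false = z≤n
    ... | true =
      subst (λ b → 6 ≤ 4 * 𝟙 b + deg U v) (sym (deg>⇒∈ U 2≤deg)) (+-monoʳ-≤ 4 2≤deg)
      where
      2≤deg : 2 ≤ deg U v
      2≤deg = ≤ᵇ⇒≤ 2 (deg U v) (subst T (sym heavy) _)

  smallCover-subcubic : ∀ U → (∀ v → deg U v ≤ 3) →
                        (∀ u v → U u ≡ true → u ~[ G ] v → 2 ≤ deg U v → 2 ≤ deg U u) →
                        SmallCover U
  smallCover-subcubic U subcubic heavy-closed with lovász-colouring U subcubic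
  ... | x , proper = heavyClass U x s , heavyClass-covers s proper heavy-closed , bound
    where
    open ≤-Reasoning
    cls : Bool → ℕ
    cls s = size (heavyClass U x s)
    partition : cls true + cls false ≡ size (λ v → 2 ≤ᵇ deg U v)
    partition = trans (sym (∑-distrib-+ (𝟙 ∘ heavyClass U x true) (𝟙 ∘ heavyClass U x false)))
                      (sum-cong-≗ λ v → split (2 ≤ᵇ deg U v) (x v))
      where
      split : ∀ h c → 𝟙 (h ∧ ⌊ c ≟ᵇ true ⌋) + 𝟙 (h ∧ ⌊ c ≟ᵇ false ⌋) ≡ 𝟙 h
      split false _     = refl
      split true  false = refl
      split true  true  = refl
    smaller : Σ Bool λ s → 2 * cls s ≤ cls true + cls false
    smaller with ≤-total (cls true) (cls false)
    ... | inj₁ t≤f = true , +-monoʳ-≤ (cls true) (≤-trans (≤-reflexive (+-identityʳ _)) t≤f)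
    ... | inj₂ f≤t = false , ≤-trans (≤-reflexive (cong (cls false +_) (+-identityʳ _)))
                                     (+-monoˡ-≤ (cls false) f≤t)
    s = proj₁ smaller
    bound : 12 * cls s ≤ potential U
    bound = begin
      12 * cls s                      ≡⟨ *-assoc 6 2 (cls s) ⟩
      6 * (2 * cls s)                 ≤⟨ *-monoʳ-≤ 6 (proj₂ smaller) ⟩
      6 * (cls true + cls false)      ≡⟨ cong (6 *_) partition ⟩
      6 * size (λ v → 2 ≤ᵇ deg U v)   ≤⟨ heavy≤potential U ⟩
      potential U                     ∎

  smallCover : ∀ U → SmallCover U
  smallCover U = go U (On.wellFounded size <-wellFounded U)
    where
    go : ∀ U → Acc (_<_ on size) U → SmallCover U
    go U (acc smaller) with any? (λ v → 4 ≤? deg U v)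
    ... | yes (v , 4≤deg) =
      smallCover-high-degree v 4≤deg (go (U ─ v) (smaller shrinks))
      where
      shrinks : size (U ─ v) < size U
      shrinks = ≤-reflexive (sym (size-─ v (deg>⇒∈ U 4≤deg)))
    ... | no no-high
      with any? (λ u → any? λ v →
             (U u ≟ᵇ true) ×-dec T? (adj G u v) ×-dec (deg U u ≤? 1) ×-dec (2 ≤? deg U v))
    ...   | yes (u , v , Uu , u~v , deg-u≤1 , 2≤deg-v) =
      smallCover-pendant Uu u~v deg-u≤1 2≤deg-v (go ((U ─ v) ─ u) (smaller shrinks))
      where
      shrinks : size ((U ─ v) ─ u) < size U
      shrinks = subst (size ((U ─ v) ─ u) <_)
        (sym (trans (size-─ v (deg>⇒∈ U 2≤deg-v))
                    (cong suc (size-─ u (updateAt-minimal-true (~-irrefl u~v) Uu)))))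
        (s≤s (n≤1+n _))
    ...   | no no-pendant = smallCover-subcubic U subcubic heavy-closed
      where
      subcubic : ∀ v → deg U v ≤ 3
      subcubic v = ≤-pred (≰⇒> λ 4≤deg → no-high (v , 4≤deg))
      heavy-closed : ∀ u v → U u ≡ true → u ~[ G ] v → 2 ≤ deg U v → 2 ≤ deg U u
      heavy-closed u v Uu u~v 2≤deg-v =
        ≰⇒> λ deg-u≤1 → no-pendant (u , v , Uu , u~v , deg-u≤1 , 2≤deg-v)

  below : Fin n → Fin n → ℕ
  below u w = 𝟙 (⌊ u <? w ⌋ ∧ adj G u w)

  numEdges≡∑∑below : numEdges G ≡ ∑∑ below
  numEdges≡∑∑below = trans (sumList-allFin {n} _) (sum-cong-≗ λ u →
      trans (length-filter-T? (λ w → ⌊ u <? w ⌋ ∧ adj G u w) (allFin n)) (sumList-allFin (below u)))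

  degSum-full : degSum (λ _ → true) ≡ 2 * numEdges G
  degSum-full = begin
      degSum (λ _ → true)
        ≡⟨ sum-cong-≗ (λ u → sum-cong-≗ (split u)) ⟩
      ∑∑ (λ u w → below u w + below w u)
        ≡⟨ sum-cong-≗ (λ u → ∑-distrib-+ (below u) (λ w → below w u)) ⟩
      sum (λ u → sum (below u) + sum (λ w → below w u))
        ≡⟨ ∑-distrib-+ (λ u → sum (below u)) (λ u → sum (λ w → below w u)) ⟩
      ∑∑ below + ∑∑ (λ u w → below w u)
        ≡⟨ cong (∑∑ below +_) (∑-comm (λ u w → below w u)) ⟩
      ∑∑ below + ∑∑ below
        ≡⟨ cong (∑∑ below +_) (+-identityʳ _) ⟨
      2 * ∑∑ below
        ≡⟨ cong (2 *_) numEdges≡∑∑below ⟨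
      2 * numEdges G
        ∎
    where
    open ≡-Reasoning
    split : ∀ u w → edgeIn (λ _ → true) u w ≡ below u w + below w u
    split u w rewrite ∧-identityʳ (adj G u w) | adj-sym G w u with u <? w | w <? u
    ... | yes u<w | yes w<u = ⊥-elim (<-asym u<w w<u)
    ... | yes _   | no _    = sym (+-identityʳ _)
    ... | no _    | yes _   = refl
    ... | no u≮w  | no w≮u with <-cmp u w
    ...   | tri< u<w _ _ = ⊥-elim (u≮w u<w)
    ...   | tri> _ _ w<u = ⊥-elim (w≮u w<u)
    ...   | tri≈ _ refl _ rewrite adj-irref G u = refl

size-full : ∀ n → size {n} (λ _ → true) ≡ n
size-full zero    = refl
size-full (suc n) = cong suc (size-full n)

∣tabulate∣ : ∀ {n} (S : Fin n → Bool) → ∣ tabulate S ∣ ≡ size S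
∣tabulate∣ {zero}  S = refl
∣tabulate∣ {suc n} S with S zero
... | true  = cong suc (∣tabulate∣ (S ∘ suc))
... | false = ∣tabulate∣ (S ∘ suc)

∈-tabulate : ∀ {n} {S : Fin n → Bool} {a} → S a ≡ true → a ∈ tabulate S
∈-tabulate {S = S} {a} Sa = lookup⇒[]= a (tabulate S) (trans (lookup∘tabulate S a) Sa)

halve : ∀ s n m → 12 * s ≤ 4 * n + 2 * m → 6 * s ≤ 2 * n + m
halve s n m le = *-cancelˡ-≤ 2 (subst₂ _≤_ (twice-left s) (twice-right n m) le)
  where
  twice-left : ∀ s → 12 * s ≡ 2 * (6 * s)
  twice-left = solve-∀
  twice-right : ∀ n m → 4 * n + 2 * m ≡ 2 * (2 * n + m)
  twice-right = solve-∀

corollary3 : (n : ℕ) (G : Graph n) →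
    Σ (Subset n) λ S → Is3PathVertexCover G S × (6 * ∣ S ∣ ≤ 2 * n + numEdges G)
corollary3 n G with smallCover G (λ _ → true)
... | S , cover , bound =
  tabulate S , is-cover , subst (_≤ 2 * n + numEdges G) size≡ (halve (size S) n (numEdges G) bound′)
  where
  is-cover : Is3PathVertexCover G (tabulate S)
  is-cover a b c abc =
    Sum.map ∈-tabulate (Sum.map ∈-tabulate ∈-tabulate) (cover a b c refl refl refl abc)
  bound′ : 12 * size S ≤ 4 * n + 2 * numEdges G
  bound′ = subst (12 * size S ≤_) (cong₂ (λ k d → 4 * k + d) (size-full n) (degSum-full G)) bound
  size≡ : 6 * size S ≡ 6 * ∣ tabulate S ∣
  size≡ = cong (6 *_) (sym (∣tabulate∣ S))
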